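{- For positive integers $k_1,\ldots,k_c\ge2$, let $R_{\mathrm{cop}}(k_1,\ldots,k_c)$ be the least $n$ such that every coloring $\chi:\{1,\ldots,n\}\to\{1,\ldots,c\}$ has a color $i$ with $\chi^{ -1}(i)$ containing $k_i$ pairwise coprime integers, and write $R_{\mathrm{cop}}(k;c)=R_{\mathrm{cop}}(k,\ldots,k)$ ($c$ entries). Then for $k,c\ge 2$, $R_{\mathrm{cop}}(k;c)=p_{c(k-1)}$, and for $s,t\ge2$, $R_{\mathrm{cop}}(s,t)=p_{s+t-2}$, where $p_m$ is the $m$-th prime ($p_1=2$).
   Context: A set of pairwise coprime integers means a set of distinct positive integers any two of which have greatest common divisor $1$. -}

module Defs where

open import Data.Nat using (ℕ; zero; suc; _<_)
open import Data.Nat.Primality using (Prime; prime?)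
open import Data.Nat.Coprimality using (Coprime)
open import Data.Fin using (Fin; toℕ)
open import Data.List using (List; length)
open import Data.List.Relation.Unary.All using (All)
open import Data.List.Relation.Unary.AllPairs using (AllPairs)
open import Data.List.Relation.Unary.Unique.Propositional using (Unique)
open import Data.Product using (Σ; _×_; ∃)
open import Relation.Binary.PropositionalEquality using (_≡_)
open import Relation.Nullary using (¬_; yes; no)

-- The integer represented by x : Fin n is  toℕ x + 1, so Fin n ≅ {1,…,n}.
val : ∀ {n} → Fin n → ℕ
val x = suc (toℕ x)

HasCoprimeSet : ∀ {n c} → (Fin n → Fin c) → Fin c → ℕ → Set
HasCoprimeSet {n} χ i k =
  Σ (List (Fin n)) λ L →
    (length L ≡ k) × Unique L × All (λ x → χ x ≡ i) L
    × AllPairs (λ x y → Coprime (val x) (val y)) L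

Arrows : (c : ℕ) → (Fin c → ℕ) → ℕ → Set
Arrows c ks n = (χ : Fin n → Fin c) → ∃ λ i → HasCoprimeSet χ i (ks i)

IsRcop : (c : ℕ) → (Fin c → ℕ) → ℕ → Set
IsRcop c ks r = Arrows c ks r × (∀ m → m < r → ¬ Arrows c ks m)

primesBelow : ℕ → ℕ
primesBelow zero = zero
primesBelow (suc n) with prime? n
... | yes _ = suc (primesBelow n)
... | no _ = primesBelow n

IsNthPrime : ℕ → ℕ → Set
IsNthPrime m p = Prime p × suc (primesBelow p) ≡ m

{-# OPTIONS --safe #-}
-- Write m = ∑ᵢ (kᵢ − 1) and let p be the m-th prime.
-- Upper bound: 1 and the m + 1 primes up to p are pairwise coprime, so under any
-- colouring of {1, …, p} some colour i receives more than kᵢ − 1 of them.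
-- Lower bound: for n < p, give 1 the rank π(p) = m − 1 and each v ≥ 2 the rank
-- π(q) < π(p) of a prime factor q of v, where π counts the primes below its argument.
-- Distinct coprime numbers get distinct ranks in [0, m), so colouring by cutting
-- [0, m) into consecutive blocks of lengths kᵢ − 1 leaves at most kᵢ − 1 pairwise
-- coprime numbers of colour i.
module Submission where

open import Defs
open import Data.Nat using (ℕ; _+_; _*_; _∸_; _≤_)
open import Data.Fin using (Fin)
open import Data.Vec using (_∷_; [])
open import Data.Vec using (lookup)
open import Data.Product using (_×_; ∃)

open import Data.Bool.Base using (true; false; if_then_else_)
open import Data.Fin.Base using (zero; suc; toℕ; fromℕ<)
open import Data.Fin.Properties
  using (_≟_; any?; toℕ<n; toℕ-fromℕ<; toℕ-injective; injective⇒≤; suc-injective)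
open import Data.List.Base as List using (List; []; _∷_; length; map; filter; take; downFrom)
open import Data.List.Properties using (length-map; length-take)
open import Data.List.Membership.Propositional.Properties using (∈-lookup)
open import Data.List.Relation.Unary.All as All using (All; []; _∷_)
open import Data.List.Relation.Unary.All.Properties as All using (all-filter)
open import Data.List.Relation.Unary.AllPairs as AllPairs using (AllPairs; []; _∷_)
import Data.List.Relation.Unary.AllPairs.Properties as AllPairs
open import Data.List.Relation.Unary.Unique.Propositional using (Unique)
import Data.List.Relation.Unary.Unique.Propositional.Properties as Unique
open import Data.Nat.Base
  using (zero; suc; _<_; _≤′_; ≤′-refl; ≤′-step; _!; s≤s; z≤n; s<s; z<s; NonZero; NonTrivial; >-nonZero⁻¹)
open import Data.Nat.Coprimality using (Coprime; 1-coprimeTo; prime⇒coprime)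
open import Data.Nat.Divisibility
  using (_∣_; divides; ∣-trans; ∣⇒≤; ∣1⇒≡1; ∣m+n∣m⇒∣n; m∣m*n; m≤n⇒m!∣n!)
open import Data.Nat.ListAction using (product)
open import Data.Nat.Primality using (Prime; prime?; ¬prime[1]; prime⇒nonZero)
open import Data.Nat.Primality.Factorisation using (factorise)
import Data.Nat.Properties as ℕ
open import Data.Nat.Properties
  using ( ≤-refl; ≤-trans; <⇒≤; <⇒≢; <⇒≱; ≤⇒≯; ≮⇒≥; ≤-<-trans; n≤1+n; n<1+n; _<?_; <-cmp
        ; ≤⇒≤′; m<1+n⇒m<n∨m≡n; +-identityʳ; +-suc; *-comm; +-mono-≤; +-monoˡ-<; 1≤n!
        ; m+n∸m≡n; m≤n+m∸n; ∸-monoˡ-<; ∸-monoʳ-<; ∸-cancelʳ-≡; m≤n⇒m⊓n≡m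
        ; module ≤-Reasoning)
open import Data.Product using (_,_; proj₁; proj₂; map₁)
open import Data.Product.Properties using (×-≡,≡→≡)
open import Data.Sum using (inj₁; inj₂)
open import Function using (_∘_; Injective)
open import Relation.Binary.Definitions using (tri<; tri≈; tri>)
open import Relation.Binary.PropositionalEquality
  using (_≡_; _≢_; refl; sym; trans; cong; cong₂; subst; module ≡-Reasoning)
open import Relation.Nullary using (¬_; yes; no; does; contradiction)

open import Algebra.Properties.CommutativeMonoid.Sum ℕ.+-0-commutativeMonoid
  using (sum; sum-cong-≗; ∑-distrib-+; sum-replicate-zero)

private
  variable
    A : Set
    c n : ℕ

primesBelow-suc : ∀ n → primesBelow n ≤ primesBelow (suc n)
primesBelow-suc n with prime? n
... | yes _ = n≤1+n _
... | no _  = ≤-refl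

primesBelow-suc-prime : ∀ {p} → Prime p → primesBelow (suc p) ≡ suc (primesBelow p)
primesBelow-suc-prime {p} p-prime with prime? p
... | yes _       = refl
... | no ¬p-prime = contradiction p-prime ¬p-prime

primesBelow-mono-≤ : ∀ {m n} → m ≤ n → primesBelow m ≤ primesBelow n
primesBelow-mono-≤ = mono ∘ ≤⇒≤′
  where
  mono : ∀ {m n} → m ≤′ n → primesBelow m ≤ primesBelow n
  mono ≤′-refl           = ≤-refl
  mono (≤′-step {n} m≤n) = ≤-trans (mono m≤n) (primesBelow-suc n)

primesBelow-mono-<-prime : ∀ {q n} → Prime q → q < n → primesBelow q < primesBelow n
primesBelow-mono-<-prime q-prime q<n =
  subst (_≤ _) (primesBelow-suc-prime q-prime) (primesBelow-mono-≤ q<n)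

primesBelow-injective-prime : ∀ {p q} → Prime p → Prime q →
  primesBelow p ≡ primesBelow q → p ≡ q
primesBelow-injective-prime {p} {q} p-prime q-prime eq with <-cmp p q
... | tri< p<q _ _ = contradiction eq (<⇒≢ (primesBelow-mono-<-prime p-prime p<q))
... | tri≈ _ p≡q _ = p≡q
... | tri> _ _ q<p = contradiction (sym eq) (<⇒≢ (primesBelow-mono-<-prime q-prime q<p))

prime-at-index : ∀ {j} n → j < primesBelow n → ∃ λ p → Prime p × primesBelow p ≡ j
prime-at-index (suc n) j<π with prime? n
... | no _ = prime-at-index n j<π
... | yes n-prime with m<1+n⇒m<n∨m≡n j<π
...   | inj₁ j<π′ = prime-at-index n j<π′
...   | inj₂ refl = n , n-prime , refl

primeFactor : ∀ {n} → 1 < n → ∃ λ p → Prime p × p ∣ n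
primeFactor {n@(suc (suc _))} (s≤s (s≤s z≤n)) with factorise n
... | record { factors = p ∷ ps ; isFactorisation = n≡p*ps ; factorsPrime = p-prime ∷ _ } =
  p , p-prime , divides (product ps) (trans n≡p*ps (*-comm p (product ps)))

m≤n⇒m∣n! : ∀ {m n} .{{_ : NonZero m}} → m ≤ n → m ∣ n !
m≤n⇒m∣n! {suc m} m≤n = ∣-trans (m∣m*n (m !)) (m≤n⇒m!∣n! m≤n)

-- Euclid: a prime factor of n! + 1 cannot be at most n.
prime-above : ∀ n → ∃ λ p → Prime p × n < p
prime-above n
  with p , p-prime , p∣n!+1 ← primeFactor (+-monoˡ-< 1 (1≤n! n))
  with n <? p
... | yes n<p = p , p-prime , n<p
... | no n≮p  = contradiction (subst Prime p≡1 p-prime) ¬prime[1]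
  where
  p≡1 : p ≡ 1
  p≡1 = ∣1⇒≡1 (∣m+n∣m⇒∣n p∣n!+1 (m≤n⇒m∣n! {{prime⇒nonZero p-prime}} (≮⇒≥ n≮p)))

primesBelow-unbounded : ∀ j → ∃ λ n → j < primesBelow n
primesBelow-unbounded zero = 3 , s≤s z≤n
primesBelow-unbounded (suc j)
  with n , j<πn ← primesBelow-unbounded j
  with p , p-prime , n<p ← prime-above n =
  suc p , subst (suc j <_) (sym (primesBelow-suc-prime p-prime))
                (s≤s (≤-trans j<πn (primesBelow-mono-≤ (<⇒≤ n<p))))

nthPrime : ∀ m → ∃ λ p → IsNthPrime (suc m) p
nthPrime m
  with n , m<πn ← primesBelow-unbounded m
  with p , p-prime , πp≡m ← prime-at-index n m<πn =
  p , p-prime , cong suc πp≡m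

allPairs-mapWithAll : ∀ {P : A → Set} {R S : A → A → Set} {xs} →
  (∀ {x y} → P x → P y → R x y → S x y) → All P xs → AllPairs R xs → AllPairs S xs
allPairs-mapWithAll f []         []           = []
allPairs-mapWithAll f (px ∷ pxs) (Rxxs ∷ Rxs) =
  All.zipWith (λ (py , Rxy) → f px py Rxy) (pxs , Rxxs) ∷ allPairs-mapWithAll f pxs Rxs

lookup-injective : ∀ {xs : List A} → Unique xs → Injective _≡_ _≡_ (List.lookup xs)
lookup-injective (x∉xs ∷ _) {zero}  {zero}  _  = refl
lookup-injective (x∉xs ∷ _) {zero}  {suc j} eq = contradiction eq (All.lookup x∉xs (∈-lookup j))
lookup-injective (x∉xs ∷ _) {suc i} {zero}  eq = contradiction (sym eq) (All.lookup x∉xs (∈-lookup i))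
lookup-injective (_ ∷ xs!)  {suc i} {suc j} eq = cong suc (lookup-injective xs! eq)

unique⇒length≤ : ∀ {xs : List (Fin n)} → Unique xs → length xs ≤ n
unique⇒length≤ xs! = injective⇒≤ (lookup-injective xs!)

toℕ-preimage : ∀ {xs} → All (_< n) xs → ∃ λ (ys : List (Fin n)) → map toℕ ys ≡ xs
toℕ-preimage []           = [] , refl
toℕ-preimage (x<n ∷ xs<n) with ys , refl ← toℕ-preimage xs<n =
  fromℕ< x<n ∷ ys , cong (_∷ map toℕ ys) (toℕ-fromℕ< x<n)

unique-below⇒length≤ : ∀ {xs} → Unique xs → All (_< n) xs → length xs ≤ n
unique-below⇒length≤ {n} xs! xs<n with ys , refl ← toℕ-preimage xs<n =
  subst (_≤ n) (sym (length-map toℕ ys)) (unique⇒length≤ (Unique.map⁻ xs!))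

sum-const : ∀ c a → sum {c} (λ _ → a) ≡ c * a
sum-const zero    a = refl
sum-const (suc c) a = cong (a +_) (sum-const c a)

sum-mono-≤ : ∀ {f g : Fin c → ℕ} → (∀ i → f i ≤ g i) → sum f ≤ sum g
sum-mono-≤ {zero}  f≤g = z≤n
sum-mono-≤ {suc c} f≤g = +-mono-≤ (f≤g zero) (sum-mono-≤ (f≤g ∘ suc))

indicator : Fin c → Fin c → ℕ
indicator j i = if does (j ≟ i) then 1 else 0

sum-indicator : (j : Fin c) → sum (indicator j) ≡ 1
sum-indicator {suc c} zero    = cong suc (sum-replicate-zero c)
sum-indicator {suc c} (suc j) = sum-indicator j

fibre : (A → Fin c) → List A → Fin c → List A
fibre χ xs i = filter (λ x → χ x ≟ i) xs

length-fibre-∷ : ∀ (χ : A → Fin c) x xs i →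
  length (fibre χ (x ∷ xs) i) ≡ indicator (χ x) i + length (fibre χ xs i)
length-fibre-∷ χ x xs i with does (χ x ≟ i)
... | true  = refl
... | false = refl

sum-length-fibre : ∀ (χ : A → Fin c) xs → sum (λ i → length (fibre χ xs i)) ≡ length xs
sum-length-fibre {c = c} χ []       = sum-replicate-zero c
sum-length-fibre          χ (x ∷ xs) = begin
  sum (λ i → length (fibre χ (x ∷ xs) i))
    ≡⟨ sum-cong-≗ (length-fibre-∷ χ x xs) ⟩
  sum (λ i → indicator (χ x) i + length (fibre χ xs i))
    ≡⟨ ∑-distrib-+ (indicator (χ x)) _ ⟩
  sum (indicator (χ x)) + sum (λ i → length (fibre χ xs i))
    ≡⟨ cong₂ _+_ (sum-indicator (χ x)) (sum-length-fibre χ xs) ⟩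
  suc (length xs)
    ∎
  where open ≡-Reasoning

pigeonhole-fibre : ∀ (χ : A → Fin c) (w : Fin c → ℕ) xs →
  sum w < length xs → ∃ λ i → w i < length (fibre χ xs i)
pigeonhole-fibre χ w xs ∑w<len with any? (λ i → w i <? length (fibre χ xs i))
... | yes big-fibre = big-fibre
... | no ¬big-fibre = contradiction ∑w<len (≤⇒≯ (begin
  length xs                               ≡⟨ sum-length-fibre χ xs ⟨
  sum (λ i → length (fibre χ xs i))       ≤⟨ sum-mono-≤ (λ i → ≮⇒≥ (¬big-fibre ∘ (i ,_))) ⟩
  sum w                                   ∎))
  where open ≤-Reasoning

-- block w t = (i , t − (w 0 + … + w (i − 1))) for the block
-- [w 0 + … + w (i − 1), w 0 + … + w i) containing t; the last block is unbounded.
block : (Fin (suc c) → ℕ) → ℕ → Fin (suc c) × ℕ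
block {zero}  w t = zero , t
block {suc c} w t with t <? w zero
... | yes _ = zero , t
... | no _  = map₁ suc (block (w ∘ suc) (t ∸ w zero))

block-offset< : ∀ (w : Fin (suc c) → ℕ) {t} → t < sum w →
  proj₂ (block w t) < w (proj₁ (block w t))
block-offset< {zero}  w {t} t<∑w = subst (t <_) (+-identityʳ (w zero)) t<∑w
block-offset< {suc c} w {t} t<∑w with t <? w zero
... | yes t<w₀ = t<w₀
... | no t≮w₀  = block-offset< (w ∘ suc)
  (subst (t ∸ w zero <_) (m+n∸m≡n (w zero) _) (∸-monoˡ-< t<∑w (≮⇒≥ t≮w₀)))

block-injective : ∀ (w : Fin (suc c) → ℕ) → Injective _≡_ _≡_ (block w)
block-injective {zero}  w eq = cong proj₂ eq
block-injective {suc c} w {s} {t} eq with s <? w zero | t <? w zero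
... | yes _   | yes _   = cong proj₂ eq
... | yes _   | no _    = contradiction (cong proj₁ eq) λ ()
... | no _    | yes _   = contradiction (cong proj₁ eq) λ ()
... | no s≮w₀ | no t≮w₀ = ∸-cancelʳ-≡ (≮⇒≥ s≮w₀) (≮⇒≥ t≮w₀)
  (block-injective (w ∘ suc) (×-≡,≡→≡ (suc-injective (cong proj₁ eq) , cong proj₂ eq)))

unique-block-class⇒length≤ : ∀ (w : Fin (suc c) → ℕ) {i ts} → Unique ts → All (_< sum w) ts →
  All (λ t → proj₁ (block w t) ≡ i) ts → length ts ≤ w i
unique-block-class⇒length≤ w {i} {ts} ts! ts<∑w ts∈i =
  subst (_≤ w i) (length-map offset ts) (unique-below⇒length≤ offsets! offsets<wᵢ)
  where
  offset : ℕ → ℕ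
  offset = proj₂ ∘ block w
  offsets! : Unique (map offset ts)
  offsets! = AllPairs.map⁺ (allPairs-mapWithAll
    (λ s∈i t∈i s≢t eq → s≢t (block-injective w (×-≡,≡→≡ (trans s∈i (sym t∈i) , eq))))
    ts∈i ts!)
  offsets<wᵢ : All (_< w i) (map offset ts)
  offsets<wᵢ = All.map⁺ (All.zipWith
    (λ (t<∑w , t∈i) → subst (λ j → _ < w j) t∈i (block-offset< w t<∑w))
    (ts<∑w , ts∈i))

rank : ℕ → ℕ → ℕ
rank p v@(suc (suc _)) = primesBelow (proj₁ (primeFactor {v} (s<s z<s)))
rank p _               = primesBelow p

rank< : ∀ {p} v → .{{_ : NonTrivial v}} → v < p → rank p v < primesBelow p
rank< v@(suc (suc _)) v<p with q , q-prime , q∣v ← primeFactor {v} (s<s z<s) =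
  primesBelow-mono-<-prime q-prime (≤-<-trans (∣⇒≤ q∣v) v<p)

rank≤ : ∀ {p} v → v < p → rank p v ≤ primesBelow p
rank≤ zero             _   = ≤-refl
rank≤ (suc zero)       _   = ≤-refl
rank≤ v@(suc (suc _)) v<p = <⇒≤ (rank< v v<p)

rank-injective : ∀ {p u v} .{{_ : NonZero u}} .{{_ : NonZero v}} →
  u < p → v < p → Coprime u v → rank p u ≡ rank p v → u ≡ v
rank-injective {u = 1} {1} _ _ _ _ = refl
rank-injective {u = 1} {v@(suc (suc _))} _ v<p _ eq =
  contradiction (sym eq) (<⇒≢ (rank< v v<p))
rank-injective {u = u@(suc (suc _))} {1} u<p _ _ eq =
  contradiction eq (<⇒≢ (rank< u u<p))
rank-injective {u = u@(suc (suc _))} {v@(suc (suc _))} _ _ u⊥v eq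
  with q , q-prime , q∣u ← primeFactor {u} (s<s z<s)
     | r , r-prime , r∣v ← primeFactor {v} (s<s z<s)
  with refl ← primesBelow-injective-prime q-prime r-prime eq =
  contradiction (subst Prime (u⊥v (q∣u , r∣v)) q-prime) ¬prime[1]

CoprimeFamily : List (Fin n) → Set
CoprimeFamily xs = Unique xs × AllPairs (λ x y → Coprime (val x) (val y)) xs

hasCoprimeSet-fibre : ∀ (χ : Fin n → Fin c) {xs} → CoprimeFamily xs →
  ∀ {i k} → k ≤ length (fibre χ xs i) → HasCoprimeSet χ i k
hasCoprimeSet-fibre χ {xs} (xs! , xs⊥) {i} {k} k≤|fibre| =
  take k (fibre χ xs i) ,
  trans (length-take k _) (m≤n⇒m⊓n≡m k≤|fibre|) ,
  Unique.take⁺ k (Unique.filter⁺ _ xs!) ,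
  All.take⁺ k (all-filter _ xs) ,
  AllPairs.take⁺ k (AllPairs.filter⁺ _ xs⊥)

arrows-from-coprimeFamily : ∀ (ks : Fin c → ℕ) {xs : List (Fin n)} → CoprimeFamily xs →
  sum (λ i → ks i ∸ 1) < length xs → Arrows c ks n
arrows-from-coprimeFamily ks {xs} xs-cop ∑<len χ
  with i , kᵢ∸1<|fibre| ← pigeonhole-fibre χ (λ i → ks i ∸ 1) xs ∑<len =
  i , hasCoprimeSet-fibre χ xs-cop (≤-trans (m≤n+m∸n (ks i) 1) kᵢ∸1<|fibre|)

liftCoprimeFamily : ∀ {xs} → All (_< n) xs → Unique xs →
  AllPairs (λ x y → Coprime (suc x) (suc y)) xs →
  ∃ λ (ys : List (Fin n)) → CoprimeFamily ys × length ys ≡ length xs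
liftCoprimeFamily xs<n xs! xs⊥ with ys , refl ← toℕ-preimage xs<n =
  ys , (Unique.map⁻ xs! , AllPairs.map⁻ xs⊥) , sym (length-map toℕ ys)

-- x stands for the integer x + 1, as in val
shiftedOneAndPrimes : ℕ → List ℕ
shiftedOneAndPrimes n = 0 ∷ filter (λ x → prime? (suc x)) (downFrom n)

length-shiftedOneAndPrimes : ∀ n → length (shiftedOneAndPrimes n) ≡ suc (primesBelow (suc n))
length-shiftedOneAndPrimes zero = refl
length-shiftedOneAndPrimes (suc n) with prime? (suc n)
... | yes _ = cong suc (length-shiftedOneAndPrimes n)
... | no _  = length-shiftedOneAndPrimes n

shiftedOneAndPrimes-< : ∀ n → .{{_ : NonZero n}} → All (_< n) (shiftedOneAndPrimes n)
shiftedOneAndPrimes-< n = >-nonZero⁻¹ n ∷ All.filter⁺ _ (All.applyDownFrom⁺₁ _ n (λ i<n → i<n))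

shiftedOneAndPrimes-unique : ∀ n → Unique (shiftedOneAndPrimes n)
shiftedOneAndPrimes-unique n =
  All.map (λ p-prime 0≡p → ¬prime[1] (subst (Prime ∘ suc) (sym 0≡p) p-prime))
          (all-filter _ (downFrom n))
  ∷ Unique.filter⁺ _ (Unique.downFrom⁺ n)

shiftedOneAndPrimes-coprime : ∀ n → AllPairs (λ x y → Coprime (suc x) (suc y)) (shiftedOneAndPrimes n)
shiftedOneAndPrimes-coprime n =
  All.universal (1-coprimeTo ∘ suc) _
  ∷ allPairs-mapWithAll (λ x-prime _ y<x → prime⇒coprime x-prime (s<s y<x)) (all-filter _ (downFrom n))
      (AllPairs.filter⁺ _ (AllPairs.applyDownFrom⁺₁ _ n (λ j<i _ → j<i)))

arrows-at-nthPrime : ∀ (ks : Fin c → ℕ) {m p} → IsNthPrime (suc m) p →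
  sum (λ i → ks i ∸ 1) ≡ suc m → Arrows c ks p
arrows-at-nthPrime ks {m} {p} (p-prime , 1+πp≡1+m) ∑≡1+m
  with ys , ys-cop , |ys|≡ ← liftCoprimeFamily (shiftedOneAndPrimes-< p {{prime⇒nonZero p-prime}})
                               (shiftedOneAndPrimes-unique p) (shiftedOneAndPrimes-coprime p) =
  arrows-from-coprimeFamily ks ys-cop (begin-strict
    sum (λ i → ks i ∸ 1)                   ≡⟨ trans ∑≡1+m (sym 1+πp≡1+m) ⟩
    suc (primesBelow p)                    <⟨ n<1+n _ ⟩
    suc (suc (primesBelow p))              ≡⟨ cong suc (primesBelow-suc-prime p-prime) ⟨
    suc (primesBelow (suc p))              ≡⟨ length-shiftedOneAndPrimes p ⟨
    length (shiftedOneAndPrimes p)         ≡⟨ |ys|≡ ⟨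
    length ys                              ∎)
  where open ≤-Reasoning

rankColouring : (Fin (suc c) → ℕ) → ℕ → Fin n → Fin (suc c)
rankColouring w p x = proj₁ (block w (rank p (val x)))

rankColouring-class-bound : ∀ (w : Fin (suc c) → ℕ) {p} → suc (primesBelow p) ≡ sum w → n < p →
  ∀ {i} {xs : List (Fin n)} → CoprimeFamily xs → All (λ x → rankColouring w p x ≡ i) xs →
  length xs ≤ w i
rankColouring-class-bound w {p} 1+πp≡∑w n<p {i} {xs} (xs! , xs⊥) xs∈i =
  subst (_≤ w i) (length-map tag xs) (unique-block-class⇒length≤ w tags! tags<∑w (All.map⁺ xs∈i))
  where
  tag : Fin _ → ℕ
  tag x = rank p (val x)
  val<p : ∀ x → val x < p
  val<p x = ≤-<-trans (toℕ<n x) n<p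
  tags! : Unique (map tag xs)
  tags! = AllPairs.map⁺ (AllPairs.zipWith tag-distinct (xs! , xs⊥))
    where
    tag-distinct : ∀ {x y} → x ≢ y × Coprime (val x) (val y) → tag x ≢ tag y
    tag-distinct {x} {y} (x≢y , x⊥y) eq =
      x≢y (toℕ-injective (ℕ.suc-injective (rank-injective (val<p x) (val<p y) x⊥y eq)))
  tags<∑w : All (_< sum w) (map tag xs)
  tags<∑w = All.map⁺ (All.universal
    (λ x → subst (tag x <_) 1+πp≡∑w (s≤s (rank≤ (val x) (val<p x)))) xs)

¬arrows-below : ∀ (ks : Fin (suc c) → ℕ) → (∀ i → 1 ≤ ks i) →
  ∀ {p} → suc (primesBelow p) ≡ sum (λ i → ks i ∸ 1) → n < p → ¬ Arrows (suc c) ks n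
¬arrows-below ks ks≥1 {p} 1+πp≡∑w n<p arrows
  with i , xs , |xs|≡kᵢ , xs! , xs∈i , xs⊥ ← arrows (rankColouring (λ i → ks i ∸ 1) p) =
  <⇒≱ (∸-monoʳ-< z<s (ks≥1 i))
    (subst (_≤ ks i ∸ 1) |xs|≡kᵢ (rankColouring-class-bound _ 1+πp≡∑w n<p (xs! , xs⊥) xs∈i))

Rcop-is-nthPrime : ∀ (ks : Fin (suc c) → ℕ) → (∀ i → 1 ≤ ks i) →
  ∀ {m} → sum (λ i → ks i ∸ 1) ≡ suc m → ∃ λ p → IsNthPrime (suc m) p × IsRcop (suc c) ks p
Rcop-is-nthPrime ks ks≥1 {m} ∑≡1+m with p , p-nth@(_ , 1+πp≡1+m) ← nthPrime m =
  p , p-nth , arrows-at-nthPrime ks p-nth ∑≡1+m ,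
  λ n n<p → ¬arrows-below ks ks≥1 (trans 1+πp≡1+m (sym ∑≡1+m)) n<p

corollary3p3 :
    ((k c : ℕ) → 2 ≤ k → 2 ≤ c →
      ∃ λ p → IsNthPrime (c * (k ∸ 1)) p × IsRcop c (λ _ → k) p)
    × ((s t : ℕ) → 2 ≤ s → 2 ≤ t →
      ∃ λ p → IsNthPrime (s + t ∸ 2) p × IsRcop 2 (lookup (s ∷ t ∷ [])) p)
corollary3p3 = diagonal , offDiagonal
  where
  diagonal : (k c : ℕ) → 2 ≤ k → 2 ≤ c →
    ∃ λ p → IsNthPrime (c * (k ∸ 1)) p × IsRcop c (λ _ → k) p
  diagonal k c (s≤s (s≤s _)) (s≤s (s≤s _)) =
    Rcop-is-nthPrime (λ _ → k) (λ _ → s≤s z≤n) (sum-const c (k ∸ 1))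
  offDiagonal : (s t : ℕ) → 2 ≤ s → 2 ≤ t →
    ∃ λ p → IsNthPrime (s + t ∸ 2) p × IsRcop 2 (lookup (s ∷ t ∷ [])) p
  offDiagonal s@(suc (suc s′)) t@(suc (suc t′)) (s≤s (s≤s _)) (s≤s (s≤s _))
    rewrite +-suc s′ (suc t′) =
    Rcop-is-nthPrime (lookup (s ∷ t ∷ [])) (λ { zero → s≤s z≤n ; (suc zero) → s≤s z≤n })
      (cong (λ x → suc (s′ + x)) (+-identityʳ (suc t′)))
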